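{- Let $N \ge 1$ be an integer, let $d$ be an integer with $1 \le d \le 2^N-1$, and let $n$ be an integer with $0 \le n < 2^{N-1}$. Let $p = \lceil \log_2 d \rceil$, $m_{lo} = \lceil 2^{N+p}/d \rceil \bmod 2^N$ and $q = \lfloor m_{lo} n / 2^N \rfloor$. Then $n + q \le 2^N - 1$, so that $\lfloor (n+q)/2^p \rfloor$ can be computed using $N$-bit unsigned registers without overflow.
   Context: An $N$-bit unsigned register holds exactly the integers $0,1,\dots,2^N-1$. $p$ is the shift offset and $m_{lo}$ the magic number of the divisor $d$. -}

module Defs where

open import Data.Nat using (ℕ; _+_; _∸_; NonZero)
open import Data.Nat.DivMod using (_/_)

ceilDiv : (a d : ℕ) .{{_ : NonZero d}} → ℕ
ceilDiv a d = (a + d ∸ 1) / d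

module Submission where

open import Defs
open import Data.Nat using (ℕ; _+_; _*_; _∸_; _^_; _≤_; _<_; NonZero; suc; s≤s; z≤n)
open import Data.Nat.DivMod using (_/_; _%_; m%n<n; m*n/n≡m; /-monoˡ-≤)
open import Data.Nat.Logarithm using (⌈log₂_⌉)
open import Data.Nat.Properties
  using (m^n≢0; *-comm; *-monoˡ-≤; <⇒≤; <⇒≤pred; +-mono-<; +-identityʳ; ≤-<-trans)
open import Relation.Binary.PropositionalEquality using (subst; cong; sym)

-- The magic number matters only through mlo < 2 ^ N (it is reduced mod 2 ^ N), which
-- gives q ≤ n; then n + q ≤ 2n < 2 ^ N because n < 2 ^ (N - 1). No hypothesis on d is used.

m*n/o≤n : ∀ m n o .{{_ : NonZero o}} → m < o → m * n / o ≤ n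
m*n/o≤n m n o m<o = subst (m * n / o ≤_) (m*n/n≡m n o)
  (/-monoˡ-≤ o (subst (m * n ≤_) (*-comm o n) (*-monoˡ-≤ n (<⇒≤ m<o))))

<2^n⇒+≤2^[1+n]∸1 : ∀ {a b} n → a < 2 ^ n → b < 2 ^ n → a + b ≤ 2 ^ suc n ∸ 1
<2^n⇒+≤2^[1+n]∸1 {a} {b} n a<2^n b<2^n =
  <⇒≤pred (subst (a + b <_) (cong (2 ^ n +_) (sym (+-identityʳ (2 ^ n)))) (+-mono-< a<2^n b<2^n))

proposition2 : (N d n : ℕ) .{{_ : NonZero d}} → 1 ≤ N → 1 ≤ d → d ≤ 2 ^ N ∸ 1 → n < 2 ^ (N ∸ 1) →
    let p = ⌈log₂ d ⌉
        mlo = _%_ (ceilDiv (2 ^ (N + p)) d) (2 ^ N) {{m^n≢0 2 N}}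
        q = _/_ (mlo * n) (2 ^ N) {{m^n≢0 2 N}}
    in n + q ≤ 2 ^ N ∸ 1
proposition2 (suc M) d n (s≤s z≤n) _ _ n<2^M =
  <2^n⇒+≤2^[1+n]∸1 M n<2^M (≤-<-trans q≤n n<2^M)
  where
    instance
      2^N≢0 : NonZero (2 ^ suc M)
      2^N≢0 = m^n≢0 2 (suc M)
    mlo : ℕ
    mlo = ceilDiv (2 ^ (suc M + ⌈log₂ d ⌉)) d % 2 ^ suc M
    q≤n : mlo * n / 2 ^ suc M ≤ n
    q≤n = m*n/o≤n mlo n (2 ^ suc M) (m%n<n _ (2 ^ suc M))
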